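{- Let $G$ be a graph and $s:V(G)\to\mathbb{N}$ a function. Let $G'$ be an induced subgraph of $G$ and let $S=G-V(G')$. If $G$ is $s$-irreducible, then $G'$ is $s_{G,S}$-irreducible, where $s_{G,S}(v)=s(v)-d_S(v)$ for $v\in V(G')$ and $d_S(v)$ is the number of neighbors of $v$ in $S$.
   Context: A list assignment $L$ assigns a set of colors to each vertex; an $L$-coloring is a proper coloring with each vertex colored from its list. For a graph $K$ and $s:V(K)\to\mathbb{Z}$, an $s$-list assignment is a list assignment $L$ with $|L(v)|\ge s(v)$ for all $v$. $K$ is $s$-reducible if there is a proper subgraph $H\subsetneq K$ such that for every $s$-list assignment $L$ of $K$, if $H$ is $L$-colorable then $K$ is $L$-colorable; $K$ is $s$-irreducible if it is not $s$-reducible. -}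

module Defs where

open import Data.Nat using (ℕ)
open import Data.Bool using (Bool; true; false; not; _∧_)
open import Data.Fin using (Fin; _≟_)
open import Data.Fin.Properties using (any?)
open import Data.List using (List; length; filterᵇ; allFin)
open import Data.List.Membership.Propositional using (_∈_)
open import Data.List.Relation.Unary.Unique.Propositional using (Unique)
open import Data.Integer using (ℤ; +_; _-_) renaming (_≤_ to _≤ℤ_)
open import Data.Product using (Σ; _×_; ∃)
open import Data.Sum using (_⊎_)
open import Function.Definitions using (Injective)
open import Relation.Binary.PropositionalEquality using (_≡_; _≢_)
open import Relation.Nullary using (¬_; does)

record Graph (n : ℕ) : Set where
  field
    adj    : Fin n → Fin n → Bool
    sym    : ∀ u v → adj u v ≡ adj v u
    irrefl : ∀ v → adj v v ≡ false
open Graph public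

record Subgraph {n : ℕ} (K : Graph n) : Set where
  field
    inV : Fin n → Bool
    inE : Fin n → Fin n → Bool
    inE-sym : ∀ u v → inE u v ≡ inE v u
    inE-adj : ∀ u v → inE u v ≡ true → adj K u v ≡ true
    inE-inV : ∀ u v → inE u v ≡ true → inV u ≡ true
open Subgraph public

Proper : ∀ {n} {K : Graph n} → Subgraph K → Set
Proper {n} {K} H =
  (Σ (Fin n) λ v → inV H v ≡ false)
  ⊎ (Σ (Fin n) λ u → Σ (Fin n) λ v → adj K u v ≡ true × inE H u v ≡ false)

ListAssignment : ℕ → Set
ListAssignment n = Fin n → List ℕ

IsSListAssignment : ∀ {n} → (Fin n → ℤ) → ListAssignment n → Set
IsSListAssignment {n} s L = ∀ (v : Fin n) → Unique (L v) × (s v ≤ℤ + length (L v))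

SubColorable : ∀ {n} {K : Graph n} → Subgraph K → ListAssignment n → Set
SubColorable {n} H L = Σ (Fin n → ℕ) λ c →
  (∀ v → inV H v ≡ true → c v ∈ L v) × (∀ u v → inE H u v ≡ true → c u ≢ c v)

Colorable : ∀ {n} → Graph n → ListAssignment n → Set
Colorable {n} K L = Σ (Fin n → ℕ) λ c →
  (∀ v → c v ∈ L v) × (∀ u v → adj K u v ≡ true → c u ≢ c v)

Reducible : ∀ {n} → (K : Graph n) → (Fin n → ℤ) → Set
Reducible {n} K s = Σ (Subgraph K) λ H → Proper H ×
  (∀ (L : ListAssignment n) → IsSListAssignment s L → SubColorable H L → Colorable K L)

Irreducible : ∀ {n} → (K : Graph n) → (Fin n → ℤ) → Set
Irreducible K s = ¬ Reducible K s

-- The induced subgraph of G on the image of an injective map f : Fin m → Fin n.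
induced : ∀ {n m} → Graph n → (Fin m → Fin n) → Graph m
induced G f = record
  { adj = λ u v → adj G (f u) (f v)
  ; sym = λ u v → sym G (f u) (f v)
  ; irrefl = λ v → irrefl G (f v) }

outside : ∀ {n m} → (Fin m → Fin n) → Fin n → Bool
outside f w = not (does (any? (λ i → f i ≟ w)))

dS : ∀ {n m} → Graph n → (Fin m → Fin n) → Fin m → ℕ
dS {n} G f v = length (filterᵇ (λ w → outside f w ∧ adj G (f v) w) (allFin n))

-- s_{G,S}(v) = s(v) - d_S(v)  (an integer, possibly negative).
sGS : ∀ {n m} → Graph n → (Fin m → Fin n) → (Fin n → ℕ) → Fin m → ℤ
sGS G f s v = + s (f v) - + dS G f v

-- If H′ ⊊ G′ witnesses that G′ is reducible, lift it to the proper subgraph H of G containing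
-- all of S and every edge of G with an end in S whose other end is in S or in H′. An L-colouring
-- c of H forbids at each v ∈ G′ the colours c uses on the S-neighbours of v; deleting them from
-- L(v) costs at most d_S(v) colours, so the pruned lists are an s_{G,S}-assignment of G′ from
-- which c colours H′. Reducibility of G′ then colours all of G′ from the pruned lists, and gluing
-- this with c on S gives an L-colouring of G, so H would witness that G is reducible.
module Submission where

open import Defs
open import Data.Nat using (ℕ; suc; _≤_; z≤n; s≤s; _+_; _∸_)
import Data.Nat as ℕ
open import Data.Nat.Properties using (+-suc; +-comm; +-monoˡ-≤; m≤n+m; m+n∸n≡m; module ≤-Reasoning)
open import Data.Bool using (Bool; true; not; _∧_)
open import Data.Bool.Properties using (∧-comm; ∧-conicalˡ; ∧-conicalʳ; T-≡)
open import Data.Fin using (Fin; _≟_)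
open import Data.Fin.Properties using (any?)
open import Data.Integer using (+_; _-_; _⊖_)
import Data.Integer as ℤ
open import Data.Integer.Properties using ([+m]-[+n]≡m⊖n; ⊖-monoˡ-≤; ⊖-≥; drop‿+≤+)
import Data.Integer.Properties as ℤ
open import Data.List using (List; []; _∷_; length; map; filter; filterᵇ; allFin)
open import Data.List.Properties using (length-removeAt′; length-map)
open import Data.List.Membership.Propositional using (_∈_; _∉_; _─_)
open import Data.List.Membership.Propositional.Properties using (∈-filter⁺; ∈-filter⁻; ∈-map⁺; ∈-map⁻; ∈-allFin)
import Data.List.Membership.DecPropositional as DecMembership
open import Data.List.Relation.Binary.Subset.Propositional using (_⊆_)
open import Data.List.Relation.Unary.Any using (here; there)
import Data.List.Relation.Unary.All as All
open import Data.List.Relation.Unary.AllPairs using (_∷_)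
open import Data.List.Relation.Unary.Unique.Propositional using (Unique)
import Data.List.Relation.Unary.Unique.Propositional.Properties as Unique
open import Data.Product using (∃; _×_; _,_; proj₁; proj₂)
open import Data.Sum as Sum using (_⊎_; inj₁; inj₂)
open import Data.Empty using (⊥-elim)
open import Function using (_∘_; Equivalence)
open import Function.Definitions using (Injective)
open import Relation.Nullary using (¬_; Dec; yes; no)
open import Relation.Nullary.Decidable using (toSum; dec-true; dec-false; T?)
open import Relation.Unary using (Pred; Decidable)
open import Relation.Unary.Properties using (∁?)
open import Relation.Binary.Definitions using (DecidableEquality)
import Relation.Binary.PropositionalEquality as ≡
open import Relation.Binary.PropositionalEquality using (_≡_; _≢_; refl; trans; cong; cong₂; ≢-sym; module ≡-Reasoning)

module _ {a} {A : Set a} where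

  ∈-─ : ∀ {x y : A} {ys} (x∈ys : x ∈ ys) → y ∈ ys → y ≢ x → y ∈ ys ─ x∈ys
  ∈-─ (here refl) (here refl) y≢x = ⊥-elim (y≢x refl)
  ∈-─ (here refl) (there y∈ys) _   = y∈ys
  ∈-─ (there _)   (here refl)  _   = here refl
  ∈-─ (there x∈ys) (there y∈ys) y≢x = there (∈-─ x∈ys y∈ys y≢x)

  Unique∧⊆⇒length≤ : ∀ {xs ys : List A} → Unique xs → xs ⊆ ys → length xs ≤ length ys
  Unique∧⊆⇒length≤ {[]}     _             _  = z≤n
  Unique∧⊆⇒length≤ {x ∷ xs} {ys} (x∉xs ∷ xs!) xs⊆ys =
    ≡.subst (suc (length xs) ≤_) (≡.sym (length-removeAt′ ys _))
      (s≤s (Unique∧⊆⇒length≤ xs! λ y∈xs →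
        ∈-─ x∈ys (xs⊆ys (there y∈xs)) λ { refl → All.lookup x∉xs y∈xs refl }))
    where x∈ys = xs⊆ys (here refl)

  length-filter-∁ : ∀ {p} {P : Pred A p} (P? : Decidable P) xs →
    length xs ≡ length (filter P? xs) + length (filter (∁? P?) xs)
  length-filter-∁ P? [] = refl
  length-filter-∁ P? (x ∷ xs) with P? x
  ... | yes _ = cong suc (length-filter-∁ P? xs)
  ... | no _  = trans (cong suc (length-filter-∁ P? xs)) (≡.sym (+-suc _ _))

module _ {a} {A : Set a} (_≟_ : DecidableEquality A) where
  open DecMembership _≟_ using (_∈?_; _∉?_)

  length≤length-filter-∉+length : ∀ {xs} ys → Unique xs →
    length xs ≤ length (filter (_∉? ys) xs) + length ys
  length≤length-filter-∉+length {xs} ys xs! = begin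
    length xs                                 ≡⟨ length-filter-∁ (_∈? ys) xs ⟩
    length (filter (_∈? ys) xs) + length kept ≤⟨ +-monoˡ-≤ (length kept) dropped≤ys ⟩
    length ys + length kept                   ≡⟨ +-comm (length ys) (length kept) ⟩
    length kept + length ys                   ∎
    where
    open ≤-Reasoning
    kept = filter (_∉? ys) xs
    dropped≤ys : length (filter (_∈? ys) xs) ≤ length ys
    dropped≤ys = Unique∧⊆⇒length≤ (Unique.filter⁺ (_∈? ys) xs!)
                   (λ y∈ → proj₂ (∈-filter⁻ (_∈? ys) {xs = xs} y∈))

m≤n+o⇒m-o≤n : ∀ {m n o} → m ≤ n + o → + m - + o ℤ.≤ + n
m≤n+o⇒m-o≤n {m} {n} {o} m≤n+o = begin
  + m - + o     ≡⟨ [+m]-[+n]≡m⊖n m o ⟩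
  m ⊖ o         ≤⟨ ⊖-monoˡ-≤ o m≤n+o ⟩
  n + o ⊖ o     ≡⟨ ⊖-≥ (m≤n+m o n) ⟩
  + (n + o ∸ o) ≡⟨ cong +_ (m+n∸n≡m n o) ⟩
  + n           ∎
  where open ℤ.≤-Reasoning

module Lifting {n m} (G : Graph n) (f : Fin m → Fin n) (f-inj : Injective _≡_ _≡_ f) where

  InImage : Fin n → Set
  InImage w = ∃ λ i → f i ≡ w

  image? : ∀ w → Dec (InImage w)
  image? w = any? (λ i → f i ≟ w)

  extend : ∀ {A : Set} → (Fin m → A) → (Fin n → A) → Fin n → A
  extend g h w with image? w
  ... | yes (i , _) = g i
  ... | no _        = h w

  extend-image : ∀ {A : Set} (g : Fin m → A) h i → extend g h (f i) ≡ g i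
  extend-image g h i with image? (f i)
  ... | yes (j , fj≡fi) = cong g (f-inj fj≡fi)
  ... | no ∉image       = ⊥-elim (∉image (i , refl))

  extend-outside : ∀ {A : Set} (g : Fin m → A) h {w} → ¬ InImage w → extend g h w ≡ h w
  extend-outside g h {w} w∉ with image? w
  ... | yes w∈ = ⊥-elim (w∉ w∈)
  ... | no _   = refl

  data Placement (u v : Fin n) : Set where
    inside : ∀ i j → f i ≡ u → f j ≡ v → Placement u v
    across : ¬ InImage u ⊎ ¬ InImage v → Placement u v

  placement : ∀ u v → Placement u v
  placement u v with image? u | image? v
  ... | yes (i , fi≡u) | yes (j , fj≡v) = inside i j fi≡u fj≡v
  ... | no u∉          | _              = across (inj₁ u∉)
  ... | yes _          | no v∉          = across (inj₂ v∉)

  module _ (H : Subgraph (induced G f)) where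
    open ≡-Reasoning

    liftV : Fin n → Bool
    liftV = extend (inV H) (λ _ → true)

    liftV-image : ∀ i → liftV (f i) ≡ inV H i
    liftV-image = extend-image _ _

    liftV-outside : ∀ {w} → ¬ InImage w → liftV w ≡ true
    liftV-outside = extend-outside _ _

    liftE : Fin n → Fin n → Bool
    liftE u v = extend (λ i → extend (inE H i) (λ _ → crossing) v) (λ _ → crossing) u
      where crossing = (liftV u ∧ liftV v) ∧ adj G u v

    liftE-image : ∀ i j → liftE (f i) (f j) ≡ inE H i j
    liftE-image i j = begin
      liftE (f i) (f j)        ≡⟨ extend-image _ _ i ⟩
      extend (inE H i) _ (f j) ≡⟨ extend-image _ _ j ⟩
      inE H i j                ∎

    liftE-across : ∀ {u v} → ¬ InImage u ⊎ ¬ InImage v → liftE u v ≡ (liftV u ∧ liftV v) ∧ adj G u v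
    liftE-across (inj₁ u∉) = extend-outside _ _ u∉
    liftE-across {u} (inj₂ v∉) with toSum (image? u)
    ... | inj₁ (i , refl) = trans (extend-image _ _ i) (extend-outside _ _ v∉)
    ... | inj₂ u∉         = extend-outside _ _ u∉

    liftE-sym : ∀ u v → liftE u v ≡ liftE v u
    liftE-sym u v with placement u v
    ... | inside i j refl refl = begin
      liftE (f i) (f j) ≡⟨ liftE-image i j ⟩
      inE H i j         ≡⟨ inE-sym H i j ⟩
      inE H j i         ≡⟨ liftE-image j i ⟨
      liftE (f j) (f i) ∎
    ... | across outside = begin
      liftE u v                         ≡⟨ liftE-across outside ⟩
      (liftV u ∧ liftV v) ∧ adj G u v   ≡⟨ cong₂ _∧_ (∧-comm (liftV u) (liftV v)) (sym G u v) ⟩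
      (liftV v ∧ liftV u) ∧ adj G v u   ≡⟨ liftE-across (Sum.swap outside) ⟨
      liftE v u                         ∎

    liftE-adj : ∀ u v → liftE u v ≡ true → adj G u v ≡ true
    liftE-adj u v e with placement u v
    ... | inside i j refl refl = inE-adj H i j (trans (≡.sym (liftE-image i j)) e)
    ... | across outside = ∧-conicalʳ _ _ (trans (≡.sym (liftE-across outside)) e)

    liftE-liftV : ∀ u v → liftE u v ≡ true → liftV u ≡ true
    liftE-liftV u v e with placement u v
    ... | inside i j refl refl =
      trans (liftV-image i) (inE-inV H i j (trans (≡.sym (liftE-image i j)) e))
    ... | across outside =
      ∧-conicalˡ _ _ (∧-conicalˡ _ _ (trans (≡.sym (liftE-across outside)) e))

    liftE-leaving : ∀ {i w} → inV H i ≡ true → ¬ InImage w → adj G (f i) w ≡ true → liftE (f i) w ≡ true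
    liftE-leaving {i} i∈H w∉ a = trans (liftE-across (inj₂ w∉))
      (cong₂ _∧_ (cong₂ _∧_ (trans (liftV-image i) i∈H) (liftV-outside w∉)) a)

    liftE-outside : ∀ {u v} → ¬ InImage u → ¬ InImage v → adj G u v ≡ true → liftE u v ≡ true
    liftE-outside u∉ v∉ a = trans (liftE-across (inj₁ u∉))
      (cong₂ _∧_ (cong₂ _∧_ (liftV-outside u∉) (liftV-outside v∉)) a)

    lift : Subgraph G
    lift = record
      { inV = liftV ; inE = liftE ; inE-sym = liftE-sym ; inE-adj = liftE-adj ; inE-inV = liftE-liftV }

    lift-proper : Proper H → Proper lift
    lift-proper (inj₁ (i , i∉H)) = inj₁ (f i , trans (liftV-image i) i∉H)
    lift-proper (inj₂ (i , j , ij∈G , ij∉H)) = inj₂ (f i , f j , ij∈G , trans (liftE-image i j) ij∉H)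

  outside⇒∉image : ∀ {w} → outside f w ≡ true → ¬ InImage w
  outside⇒∉image {w} out w∈ with () ← trans (≡.sym out) (cong not (dec-true (image? w) w∈))

  ∉image⇒outside : ∀ {w} → ¬ InImage w → outside f w ≡ true
  ∉image⇒outside {w} w∉ = cong not (dec-false (image? w) w∉)

  outsideNeighbours : Fin m → List (Fin n)
  outsideNeighbours i = filterᵇ (λ w → outside f w ∧ adj G (f i) w) (allFin n)

  ∈-outsideNeighbours⁺ : ∀ {i w} → ¬ InImage w → adj G (f i) w ≡ true → w ∈ outsideNeighbours i
  ∈-outsideNeighbours⁺ {i} {w} w∉ a =
    ∈-filter⁺ (λ w → T? (outside f w ∧ adj G (f i) w)) (∈-allFin w)
      (Equivalence.from T-≡ (cong₂ _∧_ (∉image⇒outside w∉) a))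

  ∈-outsideNeighbours⁻ : ∀ {i w} → w ∈ outsideNeighbours i → ¬ InImage w × adj G (f i) w ≡ true
  ∈-outsideNeighbours⁻ {i} {w} w∈ =
    outside⇒∉image (∧-conicalˡ _ _ out∧adj) , ∧-conicalʳ _ _ out∧adj
    where
    out∧adj : outside f w ∧ adj G (f i) w ≡ true
    out∧adj = Equivalence.to T-≡
      (proj₂ (∈-filter⁻ (λ w → T? (outside f w ∧ adj G (f i) w)) {xs = allFin n} w∈))

  module Pruning (H : Subgraph (induced G f)) (L : ListAssignment n) (c : Fin n → ℕ)
                 (c∈L : ∀ w → liftV H w ≡ true → c w ∈ L w)
                 (c-proper : ∀ u v → liftE H u v ≡ true → c u ≢ c v) where
    open DecMembership ℕ._≟_ using (_∉?_)

    forbidden : Fin m → List ℕ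
    forbidden i = map c (outsideNeighbours i)

    pruned : ListAssignment m
    pruned i = filter (_∉? forbidden i) (L (f i))

    pruned-isSListAssignment : ∀ s → IsSListAssignment (λ v → + s v) L →
                               IsSListAssignment (sGS G f s) pruned
    pruned-isSListAssignment s L-is i =
      Unique.filter⁺ (_∉? forbidden i) L! , m≤n+o⇒m-o≤n (begin
        s (f i)                                   ≤⟨ drop‿+≤+ (proj₂ (L-is (f i))) ⟩
        length (L (f i))                          ≤⟨ length≤length-filter-∉+length ℕ._≟_ (forbidden i) L! ⟩
        length (pruned i) + length (forbidden i)  ≡⟨ cong (λ k → length (pruned i) + k) (length-map c (outsideNeighbours i)) ⟩
        length (pruned i) + dS G f i              ∎)
      where
      open ≤-Reasoning
      L! = proj₁ (L-is (f i))

    c∉forbidden : ∀ i → inV H i ≡ true → c (f i) ∉ forbidden i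
    c∉forbidden i i∈H c∈ with w , w∈ , cfi≡cw ← ∈-map⁻ c c∈
                         with w∉ , a ← ∈-outsideNeighbours⁻ w∈ =
      c-proper (f i) w (liftE-leaving H i∈H w∉ a) cfi≡cw

    restriction : SubColorable H pruned
    restriction = c ∘ f
                , (λ i i∈H → ∈-filter⁺ (_∉? forbidden i) (c∈L (f i) (trans (liftV-image H i) i∈H)) (c∉forbidden i i∈H))
                , (λ i j ij∈H → c-proper (f i) (f j) (trans (liftE-image H i j) ij∈H))

    glue : Colorable (induced G f) pruned → Colorable G L
    glue (c' , c'∈pruned , c'-proper) = extend c' c , glued∈L , glued-proper
      where
      c'∈L : ∀ i → c' i ∈ L (f i)
      c'∈L i = proj₁ (∈-filter⁻ (_∉? forbidden i) {xs = L (f i)} (c'∈pruned i))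

      c'≢c : ∀ {i w} → ¬ InImage w → adj G (f i) w ≡ true → c' i ≢ c w
      c'≢c {i} w∉ a c'i≡cw = proj₂ (∈-filter⁻ (_∉? forbidden i) {xs = L (f i)} (c'∈pruned i))
        (≡.subst (_∈ forbidden i) (≡.sym c'i≡cw) (∈-map⁺ c (∈-outsideNeighbours⁺ w∉ a)))

      glued∈L : ∀ w → extend c' c w ∈ L w
      glued∈L w with toSum (image? w)
      ... | inj₁ (i , refl) = ≡.subst (_∈ L (f i)) (≡.sym (extend-image c' c i)) (c'∈L i)
      ... | inj₂ w∉ = ≡.subst (_∈ L w) (≡.sym (extend-outside c' c w∉)) (c∈L w (liftV-outside H w∉))

      glued-proper : ∀ u v → adj G u v ≡ true → extend c' c u ≢ extend c' c v
      glued-proper u v a with toSum (image? u) | toSum (image? v)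
      ... | inj₁ (i , refl) | inj₁ (j , refl) =
        ≡.subst₂ _≢_ (≡.sym (extend-image c' c i)) (≡.sym (extend-image c' c j)) (c'-proper i j a)
      ... | inj₁ (i , refl) | inj₂ v∉ =
        ≡.subst₂ _≢_ (≡.sym (extend-image c' c i)) (≡.sym (extend-outside c' c v∉)) (c'≢c v∉ a)
      ... | inj₂ u∉ | inj₁ (j , refl) =
        ≡.subst₂ _≢_ (≡.sym (extend-outside c' c u∉)) (≡.sym (extend-image c' c j))
          (≢-sym (c'≢c u∉ (trans (sym G (f j) u) a)))
      ... | inj₂ u∉ | inj₂ v∉ =
        ≡.subst₂ _≢_ (≡.sym (extend-outside c' c u∉)) (≡.sym (extend-outside c' c v∉))
          (c-proper u v (liftE-outside H u∉ v∉ a))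

mainTheorem6 : ∀ {n m} (G : Graph n) (s : Fin n → ℕ) (f : Fin m → Fin n) →
    Injective _≡_ _≡_ f →
    Irreducible G (λ v → + s v) →
    Irreducible (induced G f) (sGS G f s)
mainTheorem6 G s f f-inj G-irreducible (H , H-proper , H-reduces) =
  G-irreducible (lift H , lift-proper H H-proper , lift-reduces)
  where
  open Lifting G f f-inj
  lift-reduces : ∀ L → IsSListAssignment (λ v → + s v) L → SubColorable (lift H) L → Colorable G L
  lift-reduces L L-is (c , c∈L , c-proper) =
    glue (H-reduces pruned (pruned-isSListAssignment s L-is) restriction)
    where open Pruning H L c c∈L c-proper
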